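{- Let $E$ be an equational theory such that the variety $\mathsf{Alg}(E)$ of its models has the property (IT) and is coherent. Then $\mathsf{Alg}^{op}_{fp}(E)$, the opposite of the category of finitely presented $E$-algebras, is an $r$-regular category.
   Context: A class $\mathbf{K}$ of algebras has (IT) ("injections are transferable") if whenever $f:\mathcal{A}\to\mathcal{B}$ is a homomorphism and $g:\mathcal{A}\to\mathcal{C}$ is an injective homomorphism, there are a homomorphism $h:\mathcal{C}\to\mathcal{E}$ and an injective homomorphism $h':\mathcal{B}\to\mathcal{E}$ with $h'\circ f=h\circ g$. $\mathbf{K}$ is coherent if finitely generated subalgebras of finitely presented algebras in $\mathbf{K}$ are finitely presented. A category is $r$-regular if it has all finite limits, epimorphisms are stable under pullback, and every arrow factors as an epimorphism followed by a regular monomorphism. -}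

module Defs where

open import Level using (Level; _⊔_; suc; 0ℓ)
open import Data.Nat using (ℕ)
open import Data.Fin using (Fin)
open import Data.Product using (Σ; _×_; _,_; proj₁; proj₂; Σ-syntax)
open import Relation.Binary using (IsEquivalence)
open import Relation.Binary.PropositionalEquality as P using (_≡_)

record Signature : Set₁ where
  field
    Op    : Set
    arity : Op → ℕ

module _ (Σg : Signature) where
  open Signature Σg

  data Term (X : Set) : Set where
    var : X → Term X
    op  : (o : Op) → (Fin (arity o) → Term X) → Term X

record Theory : Set₁ where
  field
    sig : Signature
    Ax  : Set
    ctx : Ax → ℕ
    lhs : (a : Ax) → Term sig (Fin (ctx a))
    rhs : (a : Ax) → Term sig (Fin (ctx a))

record Algebra (Σg : Signature) : Set₁ where
  open Signature Σg
  infix 4 _≈_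
  field
    Carrier  : Set
    _≈_      : Carrier → Carrier → Set
    isEquiv  : IsEquivalence _≈_
    ops      : (o : Op) → (Fin (arity o) → Carrier) → Carrier
    ops-cong : (o : Op) {xs ys : Fin (arity o) → Carrier} →
               (∀ i → xs i ≈ ys i) → ops o xs ≈ ops o ys
  open IsEquivalence isEquiv public

  ⟦_⟧ : {X : Set} → Term Σg X → (X → Carrier) → Carrier
  ⟦ var x ⟧   ρ = ρ x
  ⟦ op o ts ⟧ ρ = ops o (λ i → ⟦ ts i ⟧ ρ)

record Model (E : Theory) : Set₁ where
  open Theory E
  field
    alg : Algebra sig
  open Algebra alg public
  field
    sat : (a : Ax) (ρ : Fin (ctx a) → Carrier) → ⟦ lhs a ⟧ ρ ≈ ⟦ rhs a ⟧ ρ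

module _ {E : Theory} where
  open Theory E
  open Signature sig

  record Hom (A B : Model E) : Set where
    private
      module A = Model A
      module B = Model B
    field
      fun      : A.Carrier → B.Carrier
      cong     : ∀ {x y} → x A.≈ y → fun x B.≈ fun y
      preserve : (o : Op) (xs : Fin (arity o) → A.Carrier) →
                 fun (A.ops o xs) B.≈ B.ops o (λ i → fun (xs i))
  open Hom public

  _≈ₕ_ : {A B : Model E} → Hom A B → Hom A B → Set
  _≈ₕ_ {B = B} f g = ∀ x → Model._≈_ B (fun f x) (fun g x)

  idₕ : {A : Model E} → Hom A A
  idₕ {A} = record { fun = λ x → x ; cong = λ p → p
                   ; preserve = λ o xs → Model.refl A }

  _∘ₕ_ : {A B C : Model E} → Hom B C → Hom A B → Hom A C
  _∘ₕ_ {C = C} g f = record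
    { fun = λ x → fun g (fun f x)
    ; cong = λ p → cong g (cong f p)
    ; preserve = λ o xs → Model.trans C (cong g (preserve f o xs))
                                         (preserve g o (λ i → fun f (xs i))) }

  Injective : {A B : Model E} → Hom A B → Set
  Injective {A} {B} f = ∀ x y → Model._≈_ B (fun f x) (fun f y) → Model._≈_ A x y

  record Presentation : Set where
    field
      gens : ℕ
      nrel : ℕ
      rel  : Fin nrel → Term sig (Fin gens) × Term sig (Fin gens)

  Satisfies : (P : Presentation) (B : Model E) →
              (Fin (Presentation.gens P) → Model.Carrier B) → Set
  Satisfies P B b = ∀ k → Model._≈_ B (Model.⟦ B ⟧ (proj₁ (Presentation.rel P k)) b)
                                      (Model.⟦ B ⟧ (proj₂ (Presentation.rel P k)) b)

  IsPresentedBy : Model E → Presentation → Set₁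
  IsPresentedBy A P =
    Σ[ g ∈ (Fin (Presentation.gens P) → Model.Carrier A) ]
      (Satisfies P A g ×
       ((B : Model E) (b : Fin (Presentation.gens P) → Model.Carrier B) →
        Satisfies P B b →
        Σ[ h ∈ Hom A B ]
          ((∀ i → Model._≈_ B (fun h (g i)) (b i)) ×
           ((h' : Hom A B) → (∀ i → Model._≈_ B (fun h' (g i)) (b i)) → h' ≈ₕ h))))

  IsFinitelyPresented : Model E → Set₁
  IsFinitelyPresented A = Σ[ P ∈ Presentation ] IsPresentedBy A P

  module _ (A : Model E) {m : ℕ} (a : Fin m → Model.Carrier A) where
    private module A = Model A

    GenCarrier : Set
    GenCarrier = Σ[ x ∈ A.Carrier ] Σ[ t ∈ Term sig (Fin m) ] (A.⟦ t ⟧ a A.≈ x)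

    genAlg : Algebra sig
    genAlg = record
      { Carrier = GenCarrier
      ; _≈_ = λ x y → proj₁ x A.≈ proj₁ y
      ; isEquiv = record { refl = A.refl ; sym = A.sym ; trans = A.trans }
      ; ops = λ o xs → A.ops o (λ i → proj₁ (xs i))
                     , op o (λ i → proj₁ (proj₂ (xs i)))
                     , A.ops-cong o (λ i → proj₂ (proj₂ (xs i)))
      ; ops-cong = λ o p → A.ops-cong o p }

    private
      eval-proj : {X : Set} (t : Term sig X) (ρ : X → GenCarrier) →
                  proj₁ (Algebra.⟦ genAlg ⟧ t ρ) A.≈ A.⟦ t ⟧ (λ x → proj₁ (ρ x))
      eval-proj (var x) ρ = A.refl
      eval-proj (op o ts) ρ = A.ops-cong o (λ i → eval-proj (ts i) ρ)

    Generated : Model E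
    Generated = record
      { alg = genAlg
      ; sat = λ ax ρ → A.trans (eval-proj (lhs ax) ρ)
                        (A.trans (A.sat ax (λ x → proj₁ (ρ x)))
                                 (A.sym (eval-proj (rhs ax) ρ))) }

HasIT : Theory → Set₁
HasIT E =
  (A B C : Model E) (f : Hom A B) (g : Hom A C) → Injective g →
  Σ[ D ∈ Model E ] Σ[ h ∈ Hom C D ] Σ[ h' ∈ Hom B D ]
    (Injective h' × ((h' ∘ₕ f) ≈ₕ (h ∘ₕ g)))

Coherent : Theory → Set₁
Coherent E =
  (A : Model E) → IsFinitelyPresented A →
  (m : ℕ) (a : Fin m → Model.Carrier A) → IsFinitelyPresented (Generated A a)

record Category (o h e : Level) : Set (suc (o ⊔ h ⊔ e)) where
  infix 4 _≈_
  infixr 9 _∘_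
  field
    Obj  : Set o
    _⇒_  : Obj → Obj → Set h
    _≈_  : ∀ {X Y} → X ⇒ Y → X ⇒ Y → Set e
    isEquiv : ∀ {X Y} → IsEquivalence (_≈_ {X} {Y})
    id   : ∀ {X} → X ⇒ X
    _∘_  : ∀ {X Y Z} → Y ⇒ Z → X ⇒ Y → X ⇒ Z
    identityˡ : ∀ {X Y} {f : X ⇒ Y} → id ∘ f ≈ f
    identityʳ : ∀ {X Y} {f : X ⇒ Y} → f ∘ id ≈ f
    assoc : ∀ {W X Y Z} {f : W ⇒ X} {g : X ⇒ Y} {h : Y ⇒ Z} →
            (h ∘ g) ∘ f ≈ h ∘ (g ∘ f)
    ∘-resp-≈ : ∀ {X Y Z} {f f' : Y ⇒ Z} {g g' : X ⇒ Y} →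
               f ≈ f' → g ≈ g' → f ∘ g ≈ f' ∘ g'

_ᵒᵖ : ∀ {o h e} → Category o h e → Category o h e
C ᵒᵖ = record
  { Obj = Obj
  ; _⇒_ = λ X Y → Y ⇒ X
  ; _≈_ = _≈_
  ; isEquiv = isEquiv
  ; id = id
  ; _∘_ = λ f g → g ∘ f
  ; identityˡ = identityʳ
  ; identityʳ = identityˡ
  ; assoc = IsEquivalence.sym isEquiv assoc
  ; ∘-resp-≈ = λ p q → ∘-resp-≈ q p }
  where open Category C

module _ {o h e} (C : Category o h e) where
  open Category C

  IsTerminal : Obj → Set (o ⊔ h ⊔ e)
  IsTerminal T = (X : Obj) → Σ[ f ∈ X ⇒ T ] ((g : X ⇒ T) → g ≈ f)

  IsPullback : {X Y Z P : Obj} → X ⇒ Z → Y ⇒ Z → P ⇒ X → P ⇒ Y → Set (o ⊔ h ⊔ e)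
  IsPullback {X} {Y} {Z} {P} f g p q =
    (f ∘ p ≈ g ∘ q) ×
    ((Q : Obj) (a : Q ⇒ X) (b : Q ⇒ Y) → f ∘ a ≈ g ∘ b →
      Σ[ u ∈ Q ⇒ P ] ((p ∘ u ≈ a) × (q ∘ u ≈ b) ×
        ((u' : Q ⇒ P) → p ∘ u' ≈ a → q ∘ u' ≈ b → u' ≈ u)))

  IsEqualizer : {Eq X Y : Obj} → Eq ⇒ X → X ⇒ Y → X ⇒ Y → Set (o ⊔ h ⊔ e)
  IsEqualizer {Eq} {X} m f g =
    (f ∘ m ≈ g ∘ m) ×
    ((Q : Obj) (k : Q ⇒ X) → f ∘ k ≈ g ∘ k →
      Σ[ u ∈ Q ⇒ Eq ] ((m ∘ u ≈ k) × ((u' : Q ⇒ Eq) → m ∘ u' ≈ k → u' ≈ u)))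

  Epi : {X Y : Obj} → X ⇒ Y → Set (o ⊔ h ⊔ e)
  Epi {X} {Y} ε = {Z : Obj} (g₁ g₂ : Y ⇒ Z) → g₁ ∘ ε ≈ g₂ ∘ ε → g₁ ≈ g₂

  IsRegularMono : {X Y : Obj} → X ⇒ Y → Set (o ⊔ h ⊔ e)
  IsRegularMono {X} {Y} m = Σ[ Z ∈ Obj ] Σ[ f ∈ Y ⇒ Z ] Σ[ g ∈ Y ⇒ Z ] IsEqualizer m f g

  HasFiniteLimits : Set (o ⊔ h ⊔ e)
  HasFiniteLimits =
    (Σ[ T ∈ Obj ] IsTerminal T) ×
    ({X Y Z : Obj} (f : X ⇒ Z) (g : Y ⇒ Z) →
      Σ[ P ∈ Obj ] Σ[ p ∈ P ⇒ X ] Σ[ q ∈ P ⇒ Y ] IsPullback f g p q)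

  EpisPullbackStable : Set (o ⊔ h ⊔ e)
  EpisPullbackStable =
    {X Y Z P : Obj} (f : X ⇒ Z) (g : Y ⇒ Z) (p : P ⇒ X) (q : P ⇒ Y) →
    IsPullback f g p q → Epi g → Epi p

  EpiRegMonoFactorizations : Set (o ⊔ h ⊔ e)
  EpiRegMonoFactorizations =
    {X Y : Obj} (f : X ⇒ Y) →
    Σ[ I ∈ Obj ] Σ[ ε ∈ X ⇒ I ] Σ[ m ∈ I ⇒ Y ]
      (Epi ε × IsRegularMono m × (m ∘ ε ≈ f))

  IsRRegular : Set (o ⊔ h ⊔ e)
  IsRRegular = HasFiniteLimits × EpisPullbackStable × EpiRegMonoFactorizations

FPModel : Theory → Set₁
FPModel E = Σ[ A ∈ Model E ] IsFinitelyPresented A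

AlgFP : (E : Theory) → Category (suc 0ℓ) 0ℓ 0ℓ
AlgFP E = record
  { Obj = FPModel E
  ; _⇒_ = λ A B → Hom (proj₁ A) (proj₁ B)
  ; _≈_ = _≈ₕ_
  ; isEquiv = λ {_} {B} → record
      { refl = λ x → Model.refl (proj₁ B)
      ; sym = λ p x → Model.sym (proj₁ B) (p x)
      ; trans = λ p q x → Model.trans (proj₁ B) (p x) (q x) }
  ; id = idₕ
  ; _∘_ = _∘ₕ_
  ; identityˡ = λ {_} {B} x → Model.refl (proj₁ B)
  ; identityʳ = λ {_} {B} x → Model.refl (proj₁ B)
  ; assoc = λ {_} {_} {_} {Z} x → Model.refl (proj₁ Z)
  ; ∘-resp-≈ = λ {_} {_} {Z} {f} {f'} p q x →
      Model.trans (proj₁ Z) (cong f (q x)) (p _) }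

{-# OPTIONS --safe #-}

-- Dually, Alg_fp(E) must have finite colimits, monomorphisms stable under pushout, and
-- (regular epi, mono) factorisations.  The initial algebra has the empty presentation; the
-- pushout of X ← Z → Y is presented by the generators and relations of X and Y together with,
-- for each generator z of Z, a relation equating terms for f z and g z, and it is a pushout in
-- all of Alg(E).  Monomorphisms of Alg_fp(E) are injective (test them against the free algebra
-- on one generator).  If g is injective, (IT) gives h′ : X → D injective with h′ f = h g, and
-- the mediating u from the pushout has u p = h′, so p is injective.  Finally f : Y → X factors
-- through the subalgebra generated by the images of the generators of Y, finitely presented by
-- coherence: the inclusion is injective, and the surjection from Y is the coequalizer of a pair
-- of maps out of a free algebra listing finitely many generators of its kernel.

module Submission where

open import Defs
open import Level using (0ℓ; _⊔_)
open import Data.Nat using (ℕ; _+_)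
open import Data.Fin using (Fin; zero; _↑ˡ_; _↑ʳ_)
open import Data.Fin.Properties using (join-splitAt)
open import Data.Product using (_×_; _,_; proj₁; proj₂; Σ-syntax)
open import Data.Vec.Functional using (_++_)
open import Data.Vec.Functional.Properties using (lookup-++ˡ; lookup-++ʳ)
import Data.Vec.Functional.Relation.Unary.All.Properties as All
import Data.Vec.Functional.Relation.Binary.Pointwise.Properties as Pointwise
open import Relation.Binary using (Setoid)
import Relation.Binary.Reasoning.Setoid as SetoidReasoning
import Relation.Binary.PropositionalEquality as P

↑-elim : {m n : ℕ} (Q : Fin (m + n) → Set) →
         (∀ i → Q (i ↑ˡ n)) → (∀ j → Q (m ↑ʳ j)) → ∀ k → Q k
↑-elim {m} {n} Q left right k = P.subst Q (join-splitAt m n k) (All.++⁺ Q left right k)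

Mono : ∀ {o h e} (C : Category o h e) {X Y : Category.Obj C} → Category._⇒_ C X Y → Set (o ⊔ h ⊔ e)
Mono C {X} {Y} f = Epi (C ᵒᵖ) {Y} {X} f

Alg : Theory → Category (Level.suc 0ℓ) 0ℓ 0ℓ
Alg E = record
  { Obj = Model E
  ; _⇒_ = Hom
  ; _≈_ = _≈ₕ_
  ; isEquiv = λ {_} {B} → record
      { refl = λ _ → Model.refl B
      ; sym = λ p x → Model.sym B (p x)
      ; trans = λ p q x → Model.trans B (p x) (q x) }
  ; id = idₕ
  ; _∘_ = _∘ₕ_
  ; identityˡ = λ {_} {B} _ → Model.refl B
  ; identityʳ = λ {_} {B} _ → Model.refl B
  ; assoc = λ {_} {_} {_} {D} _ → Model.refl D
  ; ∘-resp-≈ = λ {_} {_} {D} {f} p q x → Model.trans D (cong f (q x)) (p _) }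

module _ {E : Theory} where
  open Theory E
  open Signature sig

  setoid : Model E → Setoid 0ℓ 0ℓ
  setoid B = record { isEquivalence = Model.isEquiv B }

  Equation : Set → Set
  Equation X = Term sig X × Term sig X

  infixl 8 _[_] _[_]ₑ

  _[_] : {X Y : Set} → Term sig X → (X → Term sig Y) → Term sig Y
  var x   [ σ ] = σ x
  op o ts [ σ ] = op o (λ i → ts i [ σ ])

  _[_]ₑ : {X Y : Set} → Equation X → (X → Term sig Y) → Equation Y
  e [ σ ]ₑ = proj₁ e [ σ ] , proj₂ e [ σ ]

  module _ (B : Model E) where
    open Model B

    Holds : {X : Set} → (X → Carrier) → Equation X → Set
    Holds ρ e = ⟦ proj₁ e ⟧ ρ ≈ ⟦ proj₂ e ⟧ ρ

    ⟦⟧-cong : {X : Set} (t : Term sig X) {ρ ρ' : X → Carrier} →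
              (∀ x → ρ x ≈ ρ' x) → ⟦ t ⟧ ρ ≈ ⟦ t ⟧ ρ'
    ⟦⟧-cong (var x)   ρ≈ρ' = ρ≈ρ' x
    ⟦⟧-cong (op o ts) ρ≈ρ' = ops-cong o (λ i → ⟦⟧-cong (ts i) ρ≈ρ')

    ⟦[]⟧ : {X Y : Set} (t : Term sig X) (σ : X → Term sig Y) (ρ : Y → Carrier) →
           ⟦ t [ σ ] ⟧ ρ ≈ ⟦ t ⟧ (λ x → ⟦ σ x ⟧ ρ)
    ⟦[]⟧ (var x)   σ ρ = refl
    ⟦[]⟧ (op o ts) σ ρ = ops-cong o (λ i → ⟦[]⟧ (ts i) σ ρ)

    holds-cong : {X : Set} {ρ ρ' : X → Carrier} (e : Equation X) →
                 (∀ x → ρ x ≈ ρ' x) → Holds ρ e → Holds ρ' e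
    holds-cong (l , r) ρ≈ρ' h = trans (sym (⟦⟧-cong l ρ≈ρ')) (trans h (⟦⟧-cong r ρ≈ρ'))

    holds-[]⁻ : {X Y : Set} (e : Equation X) (σ : X → Term sig Y) {ρ : Y → Carrier} →
                Holds ρ (e [ σ ]ₑ) → Holds (λ x → ⟦ σ x ⟧ ρ) e
    holds-[]⁻ (l , r) σ h = trans (sym (⟦[]⟧ l σ _)) (trans h (⟦[]⟧ r σ _))

    holds-[]⁺ : {X Y : Set} (e : Equation X) (σ : X → Term sig Y) {ρ : Y → Carrier} {ρ' : X → Carrier} →
                (∀ x → ⟦ σ x ⟧ ρ ≈ ρ' x) → Holds ρ' e → Holds ρ (e [ σ ]ₑ)
    holds-[]⁺ (l , r) σ σρ≈ρ' h =
      trans (⟦[]⟧ l σ _) (trans (⟦⟧-cong l σρ≈ρ') (trans h (sym (trans (⟦[]⟧ r σ _) (⟦⟧-cong r σρ≈ρ')))))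

    ⟦[↑ˡ]⟧ : {m n : ℕ} (t : Term sig (Fin m)) (xs : Fin m → Carrier) (ys : Fin n → Carrier) →
             ⟦ t [ (λ i → var (i ↑ˡ n)) ] ⟧ (xs ++ ys) ≈ ⟦ t ⟧ xs
    ⟦[↑ˡ]⟧ t xs ys = trans (⟦[]⟧ t _ (xs ++ ys)) (⟦⟧-cong t (λ i → reflexive (lookup-++ˡ xs ys i)))

    ⟦[↑ʳ]⟧ : {m n : ℕ} (t : Term sig (Fin n)) (xs : Fin m → Carrier) (ys : Fin n → Carrier) →
             ⟦ t [ (λ j → var (m ↑ʳ j)) ] ⟧ (xs ++ ys) ≈ ⟦ t ⟧ ys
    ⟦[↑ʳ]⟧ t xs ys = trans (⟦[]⟧ t _ (xs ++ ys)) (⟦⟧-cong t (λ j → reflexive (lookup-++ʳ xs ys j)))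

  module _ {A B : Model E} (h : Hom A B) where
    private
      module A = Model A
      module B = Model B

    fun-⟦⟧ : {X : Set} (t : Term sig X) (ρ : X → A.Carrier) →
             fun h (A.⟦ t ⟧ ρ) B.≈ B.⟦ t ⟧ (λ x → fun h (ρ x))
    fun-⟦⟧ (var x)   ρ = B.refl
    fun-⟦⟧ (op o ts) ρ = B.trans (preserve h o _) (B.ops-cong o (λ i → fun-⟦⟧ (ts i) ρ))

    identifies⇒holds : {X : Set} (e : Equation X) {ρ : X → A.Carrier} →
                       fun h (A.⟦ proj₁ e ⟧ ρ) B.≈ fun h (A.⟦ proj₂ e ⟧ ρ) →
                       Holds B (λ x → fun h (ρ x)) e
    identifies⇒holds (l , r) {ρ} p = B.trans (B.sym (fun-⟦⟧ l ρ)) (B.trans p (fun-⟦⟧ r ρ))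

    holds⇒identifies : {X : Set} (e : Equation X) {ρ : X → A.Carrier} →
                       Holds B (λ x → fun h (ρ x)) e →
                       fun h (A.⟦ proj₁ e ⟧ ρ) B.≈ fun h (A.⟦ proj₂ e ⟧ ρ)
    holds⇒identifies (l , r) {ρ} p = B.trans (fun-⟦⟧ l ρ) (B.trans p (B.sym (fun-⟦⟧ r ρ)))

    satisfies-fun : (Pr : Presentation {E}) {a : Fin (Presentation.gens Pr) → A.Carrier} →
                    Satisfies Pr A a → Satisfies Pr B (λ i → fun h (a i))
    satisfies-fun Pr s k = identifies⇒holds (Presentation.rel Pr k) (cong h (s k))

  Surjective : {A B : Model E} → Hom A B → Set
  Surjective {A} {B} h = ∀ y → Σ[ x ∈ Model.Carrier A ] Model._≈_ B (fun h x) y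

  injective-cancelˡ : {A B C : Model E} (v : Hom B C) (p : Hom A B) (w : Hom A C) →
                      (v ∘ₕ p) ≈ₕ w → Injective w → Injective p
  injective-cancelˡ {C = C} v p w v∘p≈w w-inj x y px≈py =
    w-inj x y (Model.trans C (Model.sym C (v∘p≈w x)) (Model.trans C (cong v px≈py) (v∘p≈w y)))

  module TermModel (Pr : Presentation {E}) where
    open Presentation Pr

    infix 4 _~_
    data _~_ : Term sig (Fin gens) → Term sig (Fin gens) → Set where
      ~refl  : ∀ {t} → t ~ t
      ~sym   : ∀ {t u} → t ~ u → u ~ t
      ~trans : ∀ {t u v} → t ~ u → u ~ v → t ~ v
      ~cong  : (o : Op) {ts us : Fin (arity o) → Term sig (Fin gens)} →
               (∀ i → ts i ~ us i) → op o ts ~ op o us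
      ~axiom : (a : Ax) (σ : Fin (ctx a) → Term sig (Fin gens)) → lhs a [ σ ] ~ rhs a [ σ ]
      ~rel   : (k : Fin nrel) → proj₁ (rel k) ~ proj₂ (rel k)

    algebra : Algebra sig
    algebra = record
      { Carrier = Term sig (Fin gens)
      ; _≈_ = _~_
      ; isEquiv = record { refl = ~refl ; sym = ~sym ; trans = ~trans }
      ; ops = op
      ; ops-cong = ~cong }

    ⟦⟧~[] : {X : Set} (t : Term sig X) (σ : X → Term sig (Fin gens)) → Algebra.⟦ algebra ⟧ t σ ~ t [ σ ]
    ⟦⟧~[] (var x)   σ = ~refl
    ⟦⟧~[] (op o ts) σ = ~cong o (λ i → ⟦⟧~[] (ts i) σ)

    ⟦⟧-var : (t : Term sig (Fin gens)) → Algebra.⟦ algebra ⟧ t var ~ t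
    ⟦⟧-var (var i)   = ~refl
    ⟦⟧-var (op o ts) = ~cong o (λ i → ⟦⟧-var (ts i))

    model : Model E
    model = record
      { alg = algebra
      ; sat = λ a σ → ~trans (⟦⟧~[] (lhs a) σ) (~trans (~axiom a σ) (~sym (⟦⟧~[] (rhs a) σ))) }

    var-satisfies : Satisfies Pr model var
    var-satisfies k = ~trans (⟦⟧-var (proj₁ (rel k))) (~trans (~rel k) (~sym (⟦⟧-var (proj₂ (rel k)))))

    ext : {B : Model E} (h₁ h₂ : Hom model B) →
          (∀ i → Model._≈_ B (fun h₁ (var i)) (fun h₂ (var i))) → h₁ ≈ₕ h₂
    ext {B} h₁ h₂ agree (var i)   = agree i
    ext {B} h₁ h₂ agree (op o ts) =
      Model.trans B (preserve h₁ o ts)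
        (Model.trans B (Model.ops-cong B o (λ i → ext h₁ h₂ agree (ts i)))
                       (Model.sym B (preserve h₂ o ts)))

    module _ (B : Model E) (b : Fin gens → Model.Carrier B) (b-sat : Satisfies Pr B b) where
      private module B = Model B

      eval-cong : ∀ {t u} → t ~ u → B.⟦ t ⟧ b B.≈ B.⟦ u ⟧ b
      eval-cong ~refl         = B.refl
      eval-cong (~sym p)      = B.sym (eval-cong p)
      eval-cong (~trans p q)  = B.trans (eval-cong p) (eval-cong q)
      eval-cong (~cong o p)   = B.ops-cong o (λ i → eval-cong (p i))
      eval-cong (~axiom a σ)  =
        B.trans (⟦[]⟧ B (lhs a) σ b) (B.trans (B.sat a _) (B.sym (⟦[]⟧ B (rhs a) σ b)))
      eval-cong (~rel k)      = b-sat k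

      eval : Hom model B
      eval = record { fun = λ t → B.⟦ t ⟧ b ; cong = eval-cong ; preserve = λ o ts → B.refl }

      eval-unique : (h : Hom model B) → (∀ i → fun h (var i) B.≈ b i) → h ≈ₕ eval
      eval-unique h = ext h eval

    presented : IsPresentedBy model Pr
    presented = var , var-satisfies , λ B b b-sat → eval B b b-sat , (λ i → Model.refl B) , eval-unique B b b-sat

    fp : FPModel E
    fp = model , Pr , presented

  Free : ℕ → FPModel E
  Free n = TermModel.fp (record { gens = n ; nrel = 0 ; rel = λ () })

  freeLift : {n : ℕ} (B : Model E) → (Fin n → Model.Carrier B) → Hom (proj₁ (Free n)) B
  freeLift B b = TermModel.eval _ B b (λ ())

  module FP (A : FPModel E) where
    open Model (proj₁ A) public
    open Presentation (proj₁ (proj₂ A)) public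

    presentation : Presentation {E}
    presentation = proj₁ (proj₂ A)

    gen : Fin gens → Carrier
    gen = proj₁ (proj₂ (proj₂ A))

    gen-satisfies : Satisfies presentation (proj₁ A) gen
    gen-satisfies = proj₁ (proj₂ (proj₂ (proj₂ A)))

    module _ (B : Model E) (b : Fin gens → Model.Carrier B) (b-sat : Satisfies presentation B b) where
      private universal = proj₂ (proj₂ (proj₂ (proj₂ A))) B b b-sat

      lift : Hom (proj₁ A) B
      lift = proj₁ universal

      lift-gen : ∀ i → Model._≈_ B (fun lift (gen i)) (b i)
      lift-gen = proj₁ (proj₂ universal)

      lift-unique : (h : Hom (proj₁ A) B) → (∀ i → Model._≈_ B (fun h (gen i)) (b i)) → h ≈ₕ lift
      lift-unique = proj₂ (proj₂ universal)

    ext : {B : Model E} (h₁ h₂ : Hom (proj₁ A) B) →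
          (∀ i → Model._≈_ B (fun h₁ (gen i)) (fun h₂ (gen i))) → h₁ ≈ₕ h₂
    ext {B} h₁ h₂ agree x =
      Model.trans B (lift-unique B _ h₂-sat h₁ agree x)
                    (Model.sym B (lift-unique B _ h₂-sat h₂ (λ _ → Model.refl B) x))
      where
      h₂-sat : Satisfies presentation B (λ i → fun h₂ (gen i))
      h₂-sat = satisfies-fun h₂ presentation gen-satisfies

    private
      T : Model E
      T = TermModel.model presentation

      toTerm : Hom (proj₁ A) T
      toTerm = lift T var (TermModel.var-satisfies presentation)

      toTerm-gen : ∀ i → Model._≈_ T (fun toTerm (gen i)) (var i)
      toTerm-gen = lift-gen T var (TermModel.var-satisfies presentation)

      fromTerm : Hom T (proj₁ A)
      fromTerm = TermModel.eval presentation (proj₁ A) gen gen-satisfies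

    represent : Carrier → Term sig (Fin gens)
    represent = fun toTerm

    represent-denotes : ∀ x → ⟦ represent x ⟧ gen ≈ x
    represent-denotes = ext (fromTerm ∘ₕ toTerm) idₕ (λ i → cong fromTerm (toTerm-gen i))

    fun-represent : {B : Model E} (h : Hom (proj₁ A) B) (x : Carrier) →
                    Model._≈_ B (fun h x) (Model.⟦ B ⟧ (represent x) (λ i → fun h (gen i)))
    fun-represent {B} h x = Model.trans B (cong h (sym (represent-denotes x))) (fun-⟦⟧ h (represent x) gen)

  injective⇒mono : {A B : FPModel E} (h : Hom (proj₁ A) (proj₁ B)) → Injective h → Mono (AlgFP E) {A} {B} h
  injective⇒mono h h-inj g₁ g₂ hg₁≈hg₂ x = h-inj _ _ (hg₁≈hg₂ x)

  mono⇒injective : {A B : FPModel E} (h : Hom (proj₁ A) (proj₁ B)) → Mono (AlgFP E) {A} {B} h → Injective h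
  mono⇒injective {A} {B} h h-mono x y hx≈hy = h-mono {Free 1} pick-x pick-y agree (var zero)
    where
    pick-x pick-y : Hom (proj₁ (Free 1)) (proj₁ A)
    pick-x = freeLift (proj₁ A) (λ _ → x)
    pick-y = freeLift (proj₁ A) (λ _ → y)
    agree : (h ∘ₕ pick-x) ≈ₕ (h ∘ₕ pick-y)
    agree = TermModel.ext _ (h ∘ₕ pick-x) (h ∘ₕ pick-y) (λ { zero → hx≈hy })

  initial : IsTerminal (AlgFP E ᵒᵖ) (Free 0)
  initial B = freeLift (proj₁ B) (λ ()) , λ h → TermModel.ext _ h (freeLift (proj₁ B) (λ ())) (λ ())

  module Pushout (X Y Z : FPModel E) (f : Hom (proj₁ Z) (proj₁ X)) (g : Hom (proj₁ Z) (proj₁ Y)) where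
    private
      module X = FP X
      module Y = FP Y
      module Z = FP Z

    ιˡ : Fin X.gens → Term sig (Fin (X.gens + Y.gens))
    ιˡ i = var (i ↑ˡ Y.gens)

    ιʳ : Fin Y.gens → Term sig (Fin (X.gens + Y.gens))
    ιʳ j = var (X.gens ↑ʳ j)

    fz : Fin Z.gens → Term sig (Fin X.gens)
    fz k = X.represent (fun f (Z.gen k))

    gz : Fin Z.gens → Term sig (Fin Y.gens)
    gz k = Y.represent (fun g (Z.gen k))

    glue : Fin Z.gens → Equation (Fin (X.gens + Y.gens))
    glue k = fz k [ ιˡ ] , gz k [ ιʳ ]

    relˡ : Fin X.nrel → Equation (Fin (X.gens + Y.gens))
    relˡ k = X.rel k [ ιˡ ]ₑ

    relʳ : Fin Y.nrel → Equation (Fin (X.gens + Y.gens))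
    relʳ k = Y.rel k [ ιʳ ]ₑ

    presentation : Presentation {E}
    presentation = record
      { gens = X.gens + Y.gens
      ; nrel = X.nrel + (Y.nrel + Z.gens)
      ; rel  = relˡ ++ (relʳ ++ glue) }

    Glued : (Q : Model E) → (Fin X.gens → Model.Carrier Q) → (Fin Y.gens → Model.Carrier Q) → Set
    Glued Q a b = ∀ k → Model._≈_ Q (Model.⟦ Q ⟧ (fz k) a) (Model.⟦ Q ⟧ (gz k) b)

    module _ (Q : Model E) where
      private module Q = Model Q

      satisfies⁺ : {a : Fin X.gens → Q.Carrier} {b : Fin Y.gens → Q.Carrier} →
                   Satisfies X.presentation Q a → Satisfies Y.presentation Q b → Glued Q a b →
                   Satisfies presentation Q (a ++ b)
      satisfies⁺ {a} {b} a-sat b-sat ab-glued =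
        All.++⁺ (Holds Q (a ++ b))
          (λ k → holds-[]⁺ Q (X.rel k) ιˡ (λ i → Q.reflexive (lookup-++ˡ a b i)) (a-sat k))
          (All.++⁺ (Holds Q (a ++ b))
            (λ k → holds-[]⁺ Q (Y.rel k) ιʳ (λ j → Q.reflexive (lookup-++ʳ a b j)) (b-sat k))
            (λ k → Q.trans (⟦[↑ˡ]⟧ Q (fz k) a b) (Q.trans (ab-glued k) (Q.sym (⟦[↑ʳ]⟧ Q (gz k) a b)))))

      satisfies⁻ : {c : Fin (X.gens + Y.gens) → Q.Carrier} → Satisfies presentation Q c →
                   Satisfies X.presentation Q (λ i → c (i ↑ˡ Y.gens)) ×
                   Satisfies Y.presentation Q (λ j → c (X.gens ↑ʳ j)) ×
                   Glued Q (λ i → c (i ↑ˡ Y.gens)) (λ j → c (X.gens ↑ʳ j))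
      satisfies⁻ {c} c-sat =
          (λ k → holds-[]⁻ Q (X.rel k) ιˡ (X-part k))
        , (λ k → holds-[]⁻ Q (Y.rel k) ιʳ (Y-part k))
        , (λ k → Q.trans (Q.sym (⟦[]⟧ Q (fz k) ιˡ c)) (Q.trans (glued k) (⟦[]⟧ Q (gz k) ιʳ c)))
        where
        X-part : ∀ k → Holds Q c (relˡ k)
        X-part = All.++⁻ˡ (Holds Q c) relˡ c-sat
        Y-part : ∀ k → Holds Q c (relʳ k)
        Y-part = All.++⁻ˡ (Holds Q c) relʳ (All.++⁻ʳ (Holds Q c) relˡ c-sat)
        glued : ∀ k → Holds Q c (glue k)
        glued = All.++⁻ʳ (Holds Q c) relʳ (All.++⁻ʳ (Holds Q c) relˡ c-sat)

    module _ {Q : Model E} (a : Hom (proj₁ X) Q) (b : Hom (proj₁ Y) Q) where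
      private module Q = Model Q

      commutes⇒glued : (a ∘ₕ f) ≈ₕ (b ∘ₕ g) → Glued Q (λ i → fun a (X.gen i)) (λ j → fun b (Y.gen j))
      commutes⇒glued af≈bg k =
        Q.trans (Q.sym (X.fun-represent a (fun f (Z.gen k))))
                (Q.trans (af≈bg (Z.gen k)) (Y.fun-represent b (fun g (Z.gen k))))

      glued⇒commutes : {a′ : Fin X.gens → Q.Carrier} {b′ : Fin Y.gens → Q.Carrier} →
                       (∀ i → fun a (X.gen i) Q.≈ a′ i) → (∀ j → fun b (Y.gen j) Q.≈ b′ j) →
                       Glued Q a′ b′ → (a ∘ₕ f) ≈ₕ (b ∘ₕ g)
      glued⇒commutes {a′} {b′} a≈a′ b≈b′ glued = Z.ext (a ∘ₕ f) (b ∘ₕ g) λ k → begin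
        fun a (fun f (Z.gen k))                    ≈⟨ X.fun-represent a (fun f (Z.gen k)) ⟩
        Q.⟦ fz k ⟧ (λ i → fun a (X.gen i))         ≈⟨ ⟦⟧-cong Q (fz k) a≈a′ ⟩
        Q.⟦ fz k ⟧ a′                              ≈⟨ glued k ⟩
        Q.⟦ gz k ⟧ b′                              ≈⟨ ⟦⟧-cong Q (gz k) b≈b′ ⟨
        Q.⟦ gz k ⟧ (λ j → fun b (Y.gen j))         ≈⟨ Y.fun-represent b (fun g (Z.gen k)) ⟨
        fun b (fun g (Z.gen k))                    ∎
        where open SetoidReasoning (setoid Q)

    fp : FPModel E
    fp = TermModel.fp presentation

    private
      Pm : Model E
      Pm = proj₁ fp

      ιˡ-satisfies : Satisfies X.presentation Pm ιˡ
      ιˡ-satisfies = proj₁ (satisfies⁻ Pm (TermModel.var-satisfies presentation))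

      ιʳ-satisfies : Satisfies Y.presentation Pm ιʳ
      ιʳ-satisfies = proj₁ (proj₂ (satisfies⁻ Pm (TermModel.var-satisfies presentation)))

      ι-glued : Glued Pm ιˡ ιʳ
      ι-glued = proj₂ (proj₂ (satisfies⁻ Pm (TermModel.var-satisfies presentation)))

    p : Hom (proj₁ X) Pm
    p = X.lift Pm ιˡ ιˡ-satisfies

    q : Hom (proj₁ Y) Pm
    q = Y.lift Pm ιʳ ιʳ-satisfies

    p-gen : ∀ i → Model._≈_ Pm (fun p (X.gen i)) (ιˡ i)
    p-gen = X.lift-gen Pm ιˡ ιˡ-satisfies

    q-gen : ∀ j → Model._≈_ Pm (fun q (Y.gen j)) (ιʳ j)
    q-gen = Y.lift-gen Pm ιʳ ιʳ-satisfies

    commutes : (p ∘ₕ f) ≈ₕ (q ∘ₕ g)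
    commutes = glued⇒commutes p q p-gen q-gen ι-glued

    jointly-epi : {Q : Model E} (u₁ u₂ : Hom Pm Q) →
                  (u₁ ∘ₕ p) ≈ₕ (u₂ ∘ₕ p) → (u₁ ∘ₕ q) ≈ₕ (u₂ ∘ₕ q) → u₁ ≈ₕ u₂
    jointly-epi {Q} u₁ u₂ agreeˡ agreeʳ = TermModel.ext presentation u₁ u₂ (↑-elim _
      (λ i → Q.trans (cong u₁ (Model.sym Pm (p-gen i))) (Q.trans (agreeˡ (X.gen i)) (cong u₂ (p-gen i))))
      (λ j → Q.trans (cong u₁ (Model.sym Pm (q-gen j))) (Q.trans (agreeʳ (Y.gen j)) (cong u₂ (q-gen j)))))
      where module Q = Model Q

    isPushout : IsPullback (Alg E ᵒᵖ) {proj₁ X} {proj₁ Y} {proj₁ Z} {Pm} f g p q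
    isPushout = commutes , universal
      where
      universal : (Q : Model E) (a : Hom (proj₁ X) Q) (b : Hom (proj₁ Y) Q) → (a ∘ₕ f) ≈ₕ (b ∘ₕ g) →
                  Σ[ u ∈ Hom Pm Q ] ((u ∘ₕ p) ≈ₕ a × (u ∘ₕ q) ≈ₕ b ×
                                     ((u′ : Hom Pm Q) → (u′ ∘ₕ p) ≈ₕ a → (u′ ∘ₕ q) ≈ₕ b → u′ ≈ₕ u))
      universal Q a b af≈bg = u , u∘p≈a , u∘q≈b , λ u′ u′∘p≈a u′∘q≈b →
          jointly-epi u′ u (λ x → Q.trans (u′∘p≈a x) (Q.sym (u∘p≈a x)))
                           (λ y → Q.trans (u′∘q≈b y) (Q.sym (u∘q≈b y)))
        where
        module Q = Model Q

        a′ : Fin X.gens → Q.Carrier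
        a′ i = fun a (X.gen i)

        b′ : Fin Y.gens → Q.Carrier
        b′ j = fun b (Y.gen j)

        u : Hom Pm Q
        u = TermModel.eval presentation Q (a′ ++ b′)
              (satisfies⁺ Q (satisfies-fun a X.presentation X.gen-satisfies)
                            (satisfies-fun b Y.presentation Y.gen-satisfies)
                            (commutes⇒glued a b af≈bg))

        u∘p≈a : (u ∘ₕ p) ≈ₕ a
        u∘p≈a = X.ext (u ∘ₕ p) a (λ i → Q.trans (cong u (p-gen i)) (Q.reflexive (lookup-++ˡ a′ b′ i)))

        u∘q≈b : (u ∘ₕ q) ≈ₕ b
        u∘q≈b = Y.ext (u ∘ₕ q) b (λ j → Q.trans (cong u (q-gen j)) (Q.reflexive (lookup-++ʳ a′ b′ j)))

  restrict-pushout : {X Y Z P : FPModel E} (f : Hom (proj₁ Z) (proj₁ X)) (g : Hom (proj₁ Z) (proj₁ Y))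
               (p : Hom (proj₁ X) (proj₁ P)) (q : Hom (proj₁ Y) (proj₁ P)) →
               IsPullback (Alg E ᵒᵖ) {proj₁ X} {proj₁ Y} {proj₁ Z} {proj₁ P} f g p q →
               IsPullback (AlgFP E ᵒᵖ) {X} {Y} {Z} {P} f g p q
  restrict-pushout f g p q (commutes , universal) = commutes , λ Q → universal (proj₁ Q)

  pushout-preserves-injective : HasIT E → {X Y Z P : Model E}
                                (f : Hom Z X) (g : Hom Z Y) (p : Hom X P) (q : Hom Y P) →
                                IsPullback (Alg E ᵒᵖ) {X} {Y} {Z} {P} f g p q → Injective g → Injective p
  pushout-preserves-injective it {X} {Y} {Z} f g p q (_ , universal) g-inj =
    let (D , h , h′ , h′-inj , h′f≈hg) = it Z X Y f g g-inj
        (u , u∘p≈h′ , _)              = universal D h′ h h′f≈hg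
    in injective-cancelˡ u p h′ u∘p≈h′ h′-inj

  fp-pushout-preserves-injective :
    HasIT E → {X Y Z P : FPModel E} (f : Hom (proj₁ Z) (proj₁ X)) (g : Hom (proj₁ Z) (proj₁ Y))
    (p : Hom (proj₁ X) (proj₁ P)) (q : Hom (proj₁ Y) (proj₁ P)) →
    IsPullback (AlgFP E ᵒᵖ) {X} {Y} {Z} {P} f g p q → Injective g → Injective p
  fp-pushout-preserves-injective it {X} {Y} {Z} f g p q (_ , universal) g-inj =
    let (v , v∘p≈p₀ , _) = universal PO.fp PO.p PO.q PO.commutes
    in injective-cancelˡ v p PO.p v∘p≈p₀ (pushout-preserves-injective it f g PO.p PO.q PO.isPushout g-inj)
    where module PO = Pushout X Y Z f g

  module _ (Y I : FPModel E) (m : Hom (proj₁ Y) (proj₁ I)) (m-surj : Surjective m) where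
    private
      module Y = FP Y
      module I = FP I

      preimage : Fin I.gens → Y.Carrier
      preimage j = proj₁ (m-surj (I.gen j))

      m-preimage : ∀ j → fun m (preimage j) I.≈ I.gen j
      m-preimage j = proj₂ (m-surj (I.gen j))

      image-term : Fin Y.gens → Term sig (Fin I.gens)
      image-term i = I.represent (fun m (Y.gen i))

      relˡ-preimage relʳ-preimage : Fin I.nrel → Y.Carrier
      relˡ-preimage r = Y.⟦ proj₁ (I.rel r) ⟧ preimage
      relʳ-preimage r = Y.⟦ proj₂ (I.rel r) ⟧ preimage

      gen-image-preimage : Fin Y.gens → Y.Carrier
      gen-image-preimage i = Y.⟦ image-term i ⟧ preimage

      -- The kernel of m is generated by the relations of I evaluated on the chosen preimages,
      -- together with the pairs (y , t(preimages)) for y a generator of Y and t a term for m y.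
      kernelˡ kernelʳ : Fin (I.nrel + Y.gens) → Y.Carrier
      kernelˡ = relˡ-preimage ++ Y.gen
      kernelʳ = relʳ-preimage ++ gen-image-preimage

      Identifies : {Q : Model E} → Hom (proj₁ Y) Q → Y.Carrier → Y.Carrier → Set
      Identifies {Q} k x y = Model._≈_ Q (fun k x) (fun k y)

      m-identifies-kernel : ∀ j → Identifies m (kernelˡ j) (kernelʳ j)
      m-identifies-kernel = Pointwise.++⁺ (Identifies m)
        (λ r → holds⇒identifies m (I.rel r)
                 (holds-cong (proj₁ I) (I.rel r) (λ j → I.sym (m-preimage j)) (I.gen-satisfies r)))
        (λ i → begin
          fun m (Y.gen i)                                ≈⟨ I.represent-denotes (fun m (Y.gen i)) ⟨
          I.⟦ image-term i ⟧ I.gen                       ≈⟨ ⟦⟧-cong (proj₁ I) (image-term i) m-preimage ⟨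
          I.⟦ image-term i ⟧ (λ j → fun m (preimage j))  ≈⟨ fun-⟦⟧ m (image-term i) preimage ⟨
          fun m (gen-image-preimage i)                   ∎)
        where open SetoidReasoning (setoid (proj₁ I))

      a b : Hom (proj₁ (Free (I.nrel + Y.gens))) (proj₁ Y)
      a = freeLift (proj₁ Y) kernelˡ
      b = freeLift (proj₁ Y) kernelʳ

      universal : (Q : FPModel E) (k : Hom (proj₁ Y) (proj₁ Q)) → (k ∘ₕ a) ≈ₕ (k ∘ₕ b) →
                  Σ[ u ∈ Hom (proj₁ I) (proj₁ Q) ]
                    ((u ∘ₕ m) ≈ₕ k × ((u′ : Hom (proj₁ I) (proj₁ Q)) → (u′ ∘ₕ m) ≈ₕ k → u′ ≈ₕ u))
      universal Q k ka≈kb = u , u∘m≈k , unique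
        where
        module Q = Model (proj₁ Q)

        k-identifies-rel : ∀ r → Identifies k (relˡ-preimage r) (relʳ-preimage r)
        k-identifies-rel = Pointwise.++⁻ˡ (Identifies k) relˡ-preimage relʳ-preimage (λ j → ka≈kb (var j))

        k-identifies-gen : ∀ i → Identifies k (Y.gen i) (gen-image-preimage i)
        k-identifies-gen = Pointwise.++⁻ʳ (Identifies k) relˡ-preimage relʳ-preimage (λ j → ka≈kb (var j))

        k-sat : Satisfies I.presentation (proj₁ Q) (λ j → fun k (preimage j))
        k-sat r = identifies⇒holds k (I.rel r) (k-identifies-rel r)

        u : Hom (proj₁ I) (proj₁ Q)
        u = I.lift (proj₁ Q) _ k-sat

        u∘m≈k : (u ∘ₕ m) ≈ₕ k
        u∘m≈k = Y.ext (u ∘ₕ m) k λ i → begin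
          fun u (fun m (Y.gen i))                        ≈⟨ I.fun-represent u (fun m (Y.gen i)) ⟩
          Q.⟦ image-term i ⟧ (λ j → fun u (I.gen j))     ≈⟨ ⟦⟧-cong (proj₁ Q) (image-term i) (I.lift-gen (proj₁ Q) _ k-sat) ⟩
          Q.⟦ image-term i ⟧ (λ j → fun k (preimage j))  ≈⟨ fun-⟦⟧ k (image-term i) preimage ⟨
          fun k (gen-image-preimage i)                   ≈⟨ k-identifies-gen i ⟨
          fun k (Y.gen i)                                ∎
          where open SetoidReasoning (setoid (proj₁ Q))

        unique : (u′ : Hom (proj₁ I) (proj₁ Q)) → (u′ ∘ₕ m) ≈ₕ k → u′ ≈ₕ u
        unique u′ u′∘m≈k = I.lift-unique (proj₁ Q) _ k-sat u′ λ j →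
          Q.trans (cong u′ (I.sym (m-preimage j))) (u′∘m≈k (preimage j))

    surjective⇒regular-epi : IsRegularMono (AlgFP E ᵒᵖ) {I} {Y} m
    surjective⇒regular-epi =
      Free _ , a , b , TermModel.ext _ (m ∘ₕ a) (m ∘ₕ b) m-identifies-kernel , universal

  module Image (coherent : Coherent E) (X Y : FPModel E) (f : Hom (proj₁ Y) (proj₁ X)) where
    private
      module X = FP X
      module Y = FP Y

      f-gen : Fin Y.gens → X.Carrier
      f-gen i = fun f (Y.gen i)

    I : FPModel E
    I = Generated (proj₁ X) f-gen , coherent (proj₁ X) (proj₂ X) Y.gens f-gen

    inclusion : Hom (proj₁ I) (proj₁ X)
    inclusion = record { fun = proj₁ ; cong = λ x≈y → x≈y ; preserve = λ o xs → X.refl }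

    inclusion-injective : Injective inclusion
    inclusion-injective x y x≈y = x≈y

    corestriction : Hom (proj₁ Y) (proj₁ I)
    corestriction = record
      { fun = λ y → fun f y , Y.represent y , X.sym (Y.fun-represent f y)
      ; cong = cong f
      ; preserve = preserve f }

    corestriction-surjective : Surjective corestriction
    corestriction-surjective (x , t , t≈x) = Y.⟦ t ⟧ Y.gen , X.trans (fun-⟦⟧ f t Y.gen) t≈x

    factorizes : (inclusion ∘ₕ corestriction) ≈ₕ f
    factorizes y = X.refl

  hasFiniteLimits : HasFiniteLimits (AlgFP E ᵒᵖ)
  hasFiniteLimits = (Free 0 , initial) , λ {X} {Y} {Z} f g →
    let module PO = Pushout X Y Z f g
    in PO.fp , PO.p , PO.q , restrict-pushout {X} {Y} {Z} {PO.fp} f g PO.p PO.q PO.isPushout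

  -- An object of AlgFP E is not determined by its underlying model, so implicit object
  -- arguments are never inferred from homomorphisms and are supplied (or η-expanded) by hand.
  episPullbackStable : HasIT E → EpisPullbackStable (AlgFP E ᵒᵖ)
  episPullbackStable it {X} {Y} {Z} {P} f g p q pullback g-epi {W} =
    injective⇒mono {X} {P} p (fp-pushout-preserves-injective it {X} {Y} {Z} {P} f g p q pullback g-inj) {W}
    where
    g-inj : Injective g
    g-inj = mono⇒injective {Z} {Y} g (λ {W} → g-epi {W})

  epiRegMonoFactorizations : Coherent E → EpiRegMonoFactorizations (AlgFP E ᵒᵖ)
  epiRegMonoFactorizations coherent {X} {Y} f =
      I , inclusion , corestriction , (λ {W} → injective⇒mono {I} {X} inclusion inclusion-injective {W})
    , surjective⇒regular-epi Y I corestriction corestriction-surjective , factorizes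
    where open Image coherent X Y f

proposition4p6 : (E : Theory) → HasIT E → Coherent E → IsRRegular (AlgFP E ᵒᵖ)
proposition4p6 E it coherent =
    hasFiniteLimits
  , (λ {X} {Y} {Z} {P} → episPullbackStable it {X} {Y} {Z} {P})
  , (λ {X} {Y} → epiRegMonoFactorizations coherent {X} {Y})
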